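{- For any $h,\ell\in\mathbb{N}$ there exists a graph $G$ such that $G\notin\mathrm{MW}_h\mathrm{MTD}_\ell$, but $G\in\mathrm{TD}_1\mathrm{MW}_0$.
   Context: Graphs are finite and simple. Operations: $\circ,\bullet$ return the empty and the one-vertex graph; $\mathrm{Union}_t$ ($t\ge2$) is disjoint union; $\mathrm{Join}_t$ is disjoint union plus all edges between different arguments; $\mathrm{Inc}_{x,E_x}(G)=(V\cup\{x\},E\cup E_x)$ for $G=(V,E)$, $x\notin V$, $E_x\subseteq\{\{x,v\}\mid v\in V\}$; $\mathrm{Subst}_H(G_1,\dots,G_t)$ for $V(H)=\{v_1,\dots,v_t\}$ replaces each $v_i$ by a disjoint copy of $G_i$ and adds all edges between $V(G_i)$ and $V(G_j)$ whenever $\{v_i,v_j\}\in E(H)$. A graph has an algebraic expression over a set of operations if it is (up to renaming) the value of it; the empty graph corresponds to the empty expression. The nesting depth of an operation is the maximum number of expression-tree nodes labelled by it on a root-to-leaf path. $\mathrm{td}(G)$ is the least $k$ such that $G$ has an expression over $\{\circ,\mathrm{Union}\}\cup\{\mathrm{Inc}_{x,E_x}\}$ with $\mathrm{Inc}$ nesting depth at most $k$. $\mathrm{MW}_h\mathrm{MTD}_\ell$: graphs with an expression over $\{\bullet,\mathrm{Union},\mathrm{Join}\}\cup\{\mathrm{Subst}_H\mid|V(H)|\le h\}\cup\{\mathrm{Subst}_H\mid\mathrm{td}(H)\le\ell\}$. $\mathrm{TD}_k\mathrm{MW}_h$: graphs with an expression over $\{\circ,\bullet,\mathrm{Union},\mathrm{Join}\}\cup\{\mathrm{Inc}_{x,E_x}\}\cup\{\mathrm{Subst}_H\mid|V(H)|\le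 h\}$ with $\mathrm{Inc}$ nesting depth at most $k$. -}

module Defs where

open import Data.Nat using (ℕ; zero; suc; _+_; _≤_)
open import Data.Fin using (Fin; zero; suc; splitAt; _≟_)
open import Data.Bool using (Bool; true; false; not; _∧_; _∨_)
open import Data.Sum using (_⊎_; inj₁; inj₂)
open import Data.Product using (Σ; _,_; proj₁; proj₂)
open import Relation.Nullary using (yes; no)
open import Relation.Nullary.Decidable using (⌊_⌋)
open import Relation.Binary.PropositionalEquality using (_≡_; refl)
open import Function.Bundles using (_↔_; Inverse)

-- The raw Boolean relation 'adj' is read through
-- 'edge', which symmetrises it and removes loops, so every value of
-- the record denotes a finite simple graph, and every finite simple
-- graph is denoted (take adj = its adjacency).

record Graph : Set where
  constructor mkGraph
  field
    size : ℕ
    adj  : Fin size → Fin size → Bool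
open Graph public

edge : (G : Graph) → Fin (size G) → Fin (size G) → Bool
edge G u v = not ⌊ u ≟ v ⌋ ∧ (adj G u v ∨ adj G v u)

_≅_ : Graph → Graph → Set
G ≅ G' = Σ (Fin (size G) ↔ Fin (size G')) λ f →
  ∀ u v → edge G u v ≡ edge G' (Inverse.to f u) (Inverse.to f v)

emptyG : Graph
emptyG = mkGraph 0 (λ ())

oneG : Graph
oneG = mkGraph 1 (λ _ _ → false)

edgelessG : ℕ → Graph
edgelessG t = mkGraph t (λ _ _ → false)

completeG : ℕ → Graph
completeG t = mkGraph t (λ _ _ → true)

sumF : (t : ℕ) → (Fin t → ℕ) → ℕ
sumF zero    ns = 0
sumF (suc t) ns = ns zero + sumF t (λ i → ns (suc i))

split : (t : ℕ) (ns : Fin t → ℕ) → Fin (sumF t ns) → Σ (Fin t) (λ i → Fin (ns i))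
split (suc t) ns x with splitAt (ns zero) x
... | inj₁ a = zero , a
... | inj₂ y with split t (λ i → ns (suc i)) y
...   | i , b = suc i , b

substAdj : (H : Graph) (Gs : Fin (size H) → Graph) →
           (i : Fin (size H)) → Fin (size (Gs i)) →
           (j : Fin (size H)) → Fin (size (Gs j)) → Bool
substAdj H Gs i a j b with i ≟ j
... | yes refl = adj (Gs i) a b
... | no _     = edge H i j

Subst : (H : Graph) → (Fin (size H) → Graph) → Graph
Subst H Gs = mkGraph n ad
  where
  n = sumF (size H) (λ i → size (Gs i))
  ad : Fin n → Fin n → Bool
  ad x y with split (size H) (λ i → size (Gs i)) x
           | split (size H) (λ i → size (Gs i)) y
  ... | i , a | j , b = substAdj H Gs i a j b

Union : (t : ℕ) → (Fin t → Graph) → Graph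
Union t Gs = Subst (edgelessG t) Gs

Join : (t : ℕ) → (Fin t → Graph) → Graph
Join t Gs = Subst (completeG t) Gs

Inc : (G : Graph) → (Fin (size G) → Bool) → Graph
Inc G S = mkGraph (suc (size G)) ad
  where
  ad : Fin (suc (size G)) → Fin (suc (size G)) → Bool
  ad zero    (suc v) = S v
  ad (suc u) (suc v) = adj G u v
  ad _       _       = false

-- Expressions, as inductive "has an expression" predicates.
-- The ℕ index is an upper bound on the nesting depth of Inc.

data TDExpr : ℕ → Graph → Set where
  circ  : ∀ {k} → TDExpr k emptyG
  union : ∀ {k} t → 2 ≤ t → (Gs : Fin t → Graph) →
          (∀ i → TDExpr k (Gs i)) → TDExpr k (Union t Gs)
  inc   : ∀ {k} G (S : Fin (size G) → Bool) →
          TDExpr k G → TDExpr (suc k) (Inc G S)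
  iso   : ∀ {k G G'} → TDExpr k G → G ≅ G' → TDExpr k G'

tdAtMost : ℕ → Graph → Set
tdAtMost ℓ H = TDExpr ℓ H

data MWMTD (h ℓ : ℕ) : Graph → Set where
  emptyE : MWMTD h ℓ emptyG
  bullet : MWMTD h ℓ oneG
  union  : ∀ t → 2 ≤ t → (Gs : Fin t → Graph) →
           (∀ i → MWMTD h ℓ (Gs i)) → MWMTD h ℓ (Union t Gs)
  join   : ∀ t → 2 ≤ t → (Gs : Fin t → Graph) →
           (∀ i → MWMTD h ℓ (Gs i)) → MWMTD h ℓ (Join t Gs)
  substS : (H : Graph) → size H ≤ h → (Gs : Fin (size H) → Graph) →
           (∀ i → MWMTD h ℓ (Gs i)) → MWMTD h ℓ (Subst H Gs)
  substT : (H : Graph) → tdAtMost ℓ H → (Gs : Fin (size H) → Graph) →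
           (∀ i → MWMTD h ℓ (Gs i)) → MWMTD h ℓ (Subst H Gs)
  iso    : ∀ {G G'} → MWMTD h ℓ G → G ≅ G' → MWMTD h ℓ G'

data TDMW (h : ℕ) : ℕ → Graph → Set where
  circ   : ∀ {k} → TDMW h k emptyG
  bullet : ∀ {k} → TDMW h k oneG
  union  : ∀ {k} t → 2 ≤ t → (Gs : Fin t → Graph) →
           (∀ i → TDMW h k (Gs i)) → TDMW h k (Union t Gs)
  join   : ∀ {k} t → 2 ≤ t → (Gs : Fin t → Graph) →
           (∀ i → TDMW h k (Gs i)) → TDMW h k (Join t Gs)
  inc    : ∀ {k} G (S : Fin (size G) → Bool) →
           TDMW h k G → TDMW h (suc k) (Inc G S)
  substS : ∀ {k} (H : Graph) → size H ≤ h → (Gs : Fin (size H) → Graph) →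
           (∀ i → TDMW h k (Gs i)) → TDMW h k (Subst H Gs)
  iso    : ∀ {k G G'} → TDMW h k G → G ≅ G' → TDMW h k G'

MW_MTD_ : ℕ → ℕ → Graph → Set
MW h MTD ℓ = MWMTD h ℓ

TD_MW_ : ℕ → ℕ → Graph → Set
TD k MW h = TDMW h k

module Submission where

-- The witness, for n = h + ℓ + 2, is the half graph on a clique u₀ … uₙ₋₁ and an independent
-- set w₀ … wₙ₋₁ (uⱼ ∼ wᵢ iff j ≤ i) together with an apex adjacent to exactly the wᵢ.
-- Without the apex it is a cograph, so the graph is in TD₁MW₀. The graph is prime: a colouring
-- whose classes are modules and which identifies two vertices is constant. So a copy of it in
-- Subst_H(G₁, …, Gₜ) either lies in one Gᵢ or meets every block at most once and yields an
-- induced copy in H. The latter is impossible for H edgeless or complete (the pattern has edges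
-- and non-edges), for |V(H)| ≤ h (the n-clique does not fit), and for td(H) ≤ ℓ, as a graph of
-- tree-depth ℓ has no clique of size ℓ + 1: a union keeps a clique inside one part and each Inc
-- removes at most one of its vertices.

open import Defs
open import Data.Nat using (ℕ; zero; suc; _+_; _≤_; z≤n; s≤s; s≤s⁻¹)
open import Data.Nat.Properties using (≤-trans; n≤1+n; 1+n≰n; <⇒≱; m≤m+n; m≤n+m)
import Data.Fin as Fin
open import Data.Fin using (Fin; zero; suc; _≟_; fromℕ; punchIn; punchOut; splitAt; _↑ˡ_; _↑ʳ_)
open import Data.Fin.Properties
  using (splitAt-↑ˡ; splitAt-↑ʳ; join-splitAt; suc-injective; punchIn-injective; punchInᵢ≢i;
         punchIn-punchOut; any?; injective⇒≤; _≤?_; ≤fromℕ; <-cmp)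
  renaming (≤-refl to ≤ᶠ-refl)
open import Data.Bool using (Bool; true; false; not; _∧_; _∨_)
open import Data.Bool.Properties using (∨-idem; ∨-comm; ∨-identityʳ; ∧-zeroʳ)
open import Data.Sum using (_⊎_; inj₁; inj₂; [_,_]′)
open import Data.Product using (Σ; _,_; proj₁; proj₂; _×_; uncurry)
open import Data.Vec.Functional using ([]; _∷_)
open import Data.Empty using (⊥-elim)
open import Function using (_∘_)
open import Function.Bundles using (Inverse; _⇔_; mk⇔)
open import Function.Definitions using (Injective)
open import Relation.Binary using (tri<; tri≈; tri>)
open import Relation.Nullary using (Dec; yes; no; ¬_)
open import Relation.Nullary.Decidable using (⌊_⌋; isYes≗does; dec-true; dec-false; does-⇔)
open import Relation.Binary.PropositionalEquality

⌊⌋-true : ∀ {A : Set} (a? : Dec A) → A → ⌊ a? ⌋ ≡ true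
⌊⌋-true a? a = trans (isYes≗does a?) (dec-true a? a)

⌊⌋-false : ∀ {A : Set} (a? : Dec A) → ¬ A → ⌊ a? ⌋ ≡ false
⌊⌋-false a? ¬a = trans (isYes≗does a?) (dec-false a? ¬a)

⌊⌋-⇔ : ∀ {A B : Set} → A ⇔ B → (a? : Dec A) (b? : Dec B) → ⌊ a? ⌋ ≡ ⌊ b? ⌋
⌊⌋-⇔ A⇔B a? b? = trans (isYes≗does a?) (trans (does-⇔ A⇔B a? b?) (sym (isYes≗does b?)))

true-≢-false : ∀ {x y : Bool} → x ≡ true → y ≡ false → x ≢ y
true-≢-false refl refl ()

edge-sym : ∀ G u v → edge G u v ≡ edge G v u
edge-sym G u v =
  cong₂ (λ d a → not d ∧ a) (⌊⌋-⇔ (mk⇔ sym sym) (u ≟ v) (v ≟ u)) (∨-comm (adj G u v) (adj G v u))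

edge-irrefl : ∀ G u → edge G u u ≡ false
edge-irrefl G u rewrite ⌊⌋-true (u ≟ u) refl = refl

adjacent⇒≢ : ∀ G {u v} → edge G u v ≡ true → u ≢ v
adjacent⇒≢ G {u} uv refl = true-≢-false uv (edge-irrefl G u) refl

edge-edgeless : ∀ {t} (i j : Fin t) → edge (edgelessG t) i j ≡ false
edge-edgeless i j = ∧-zeroʳ _

edge-complete : ∀ {t} {i j : Fin t} → i ≢ j → edge (completeG t) i j ≡ true
edge-complete {i = i} {j} i≢j rewrite ⌊⌋-false (i ≟ j) i≢j = refl

edge-Inc-zero : ∀ G S v → edge (Inc G S) zero (suc v) ≡ S v
edge-Inc-zero G S v = ∨-identityʳ (S v)

edge-Inc-suc : ∀ G S u v → edge (Inc G S) (suc u) (suc v) ≡ edge G u v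
edge-Inc-suc G S u v =
  cong (λ d → not d ∧ (adj G u v ∨ adj G v u))
       (⌊⌋-⇔ (mk⇔ suc-injective (cong suc)) (suc u ≟ suc v) (u ≟ v))

embed : (t : ℕ) (ns : Fin t → ℕ) (i : Fin t) → Fin (ns i) → Fin (sumF t ns)
embed (suc t) ns zero    a = a ↑ˡ sumF t (ns ∘ suc)
embed (suc t) ns (suc i) a = ns zero ↑ʳ embed t (ns ∘ suc) i a

split-embed : ∀ t ns i a → split t ns (embed t ns i a) ≡ (i , a)
split-embed (suc t) ns zero a rewrite splitAt-↑ˡ (ns zero) a (sumF t (ns ∘ suc)) = refl
split-embed (suc t) ns (suc i) a
  rewrite splitAt-↑ʳ (ns zero) (sumF t (ns ∘ suc)) (embed t (ns ∘ suc) i a)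
        | split-embed t (ns ∘ suc) i a = refl

embed-split : ∀ t ns y → embed t ns (proj₁ (split t ns y)) (proj₂ (split t ns y)) ≡ y
embed-split (suc t) ns y with splitAt (ns zero) y in eq
... | inj₁ a = trans (cong (Fin.join _ _) (sym eq)) (join-splitAt (ns zero) _ y)
... | inj₂ z = begin
  ns zero ↑ʳ embed t (ns ∘ suc) _ _ ≡⟨ cong (ns zero ↑ʳ_) (embed-split t (ns ∘ suc) z) ⟩
  ns zero ↑ʳ z                      ≡⟨ cong (Fin.join _ _) (sym eq) ⟩
  Fin.join _ _ (splitAt (ns zero) y) ≡⟨ join-splitAt (ns zero) _ y ⟩
  y                                  ∎
  where open ≡-Reasoning

embed-subst : ∀ t ns {i j} (i≡j : i ≡ j) (a : Fin (ns i)) →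
              embed t ns j (subst (λ k → Fin (ns k)) i≡j a) ≡ embed t ns i a
embed-subst t ns refl a = refl

module SubstBlocks (H : Graph) (Gs : Fin (size H) → Graph) where

  private
    S : Graph
    S = Subst H Gs
    ns : Fin (size H) → ℕ
    ns i = size (Gs i)

  ⟨_,_⟩ : (i : Fin (size H)) → Fin (size (Gs i)) → Fin (size S)
  ⟨ i , a ⟩ = embed (size H) ns i a

  locate : Fin (size S) → Σ (Fin (size H)) λ i → Fin (size (Gs i))
  locate = split (size H) ns

  locate-⟨⟩ : ∀ i a → locate ⟨ i , a ⟩ ≡ (i , a)
  locate-⟨⟩ = split-embed (size H) ns

  block : Fin (size S) → Fin (size H)
  block y = proj₁ (locate y)

  offset : (y : Fin (size S)) → Fin (size (Gs (block y)))
  offset y = proj₂ (locate y)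

  ⟨block,offset⟩ : ∀ y → ⟨ block y , offset y ⟩ ≡ y
  ⟨block,offset⟩ = embed-split (size H) ns

  block-⟨⟩ : ∀ {i j a b} → ⟨ i , a ⟩ ≡ ⟨ j , b ⟩ → i ≡ j
  block-⟨⟩ {i} {j} {a} {b} eq =
    cong proj₁ (trans (sym (split-embed _ ns i a)) (trans (cong (split _ ns) eq) (split-embed _ ns j b)))

  offset-⟨⟩ : ∀ {i a b} → ⟨ i , a ⟩ ≡ ⟨ i , b ⟩ → a ≡ b
  offset-⟨⟩ {i} {a} {b} eq
    with trans (sym (split-embed _ ns i a)) (trans (cong (split _ ns) eq) (split-embed _ ns i b))
  ... | refl = refl

  adj-⟨⟩ : ∀ i a j b → adj S ⟨ i , a ⟩ ⟨ j , b ⟩ ≡ substAdj H Gs i a j b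
  adj-⟨⟩ i a j b rewrite split-embed _ ns i a | split-embed _ ns j b = refl

  substAdj-same : ∀ i a b → substAdj H Gs i a i b ≡ adj (Gs i) a b
  substAdj-same i a b with i ≟ i
  ... | yes refl = refl
  ... | no i≢i = ⊥-elim (i≢i refl)

  substAdj-diff : ∀ {i j} a b → i ≢ j → substAdj H Gs i a j b ≡ edge H i j
  substAdj-diff {i} {j} a b i≢j with i ≟ j
  ... | yes i≡j = ⊥-elim (i≢j i≡j)
  ... | no _ = cong (λ d → not d ∧ (adj H i j ∨ adj H j i)) (⌊⌋-false (i ≟ j) i≢j)

  edge-⟨⟩-same : ∀ i a b → edge S ⟨ i , a ⟩ ⟨ i , b ⟩ ≡ edge (Gs i) a b
  edge-⟨⟩-same i a b =
    cong₂ (λ d x → not d ∧ x)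
      (⌊⌋-⇔ (mk⇔ offset-⟨⟩ (cong ⟨ i ,_⟩)) (⟨ i , a ⟩ ≟ ⟨ i , b ⟩) (a ≟ b))
      (cong₂ _∨_ (trans (adj-⟨⟩ i a i b) (substAdj-same i a b))
                 (trans (adj-⟨⟩ i b i a) (substAdj-same i b a)))

  edge-⟨⟩-diff : ∀ i a j b → i ≢ j → edge S ⟨ i , a ⟩ ⟨ j , b ⟩ ≡ edge H i j
  edge-⟨⟩-diff i a j b i≢j
    rewrite ⌊⌋-false (⟨ i , a ⟩ ≟ ⟨ j , b ⟩) (i≢j ∘ block-⟨⟩)
          | adj-⟨⟩ i a j b | adj-⟨⟩ j b i a
          | substAdj-diff a b i≢j | substAdj-diff b a (i≢j ∘ sym)
          | edge-sym H j i = ∨-idem (edge H i j)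

  edge-across : ∀ y y′ → block y ≢ block y′ → edge S y y′ ≡ edge H (block y) (block y′)
  edge-across y y′ ne = begin
    edge S y y′                                       ≡⟨ cong₂ (edge S) (sym (⟨block,offset⟩ y)) (sym (⟨block,offset⟩ y′)) ⟩
    edge S ⟨ block y , offset y ⟩ ⟨ block y′ , offset y′ ⟩ ≡⟨ edge-⟨⟩-diff (block y) (offset y) (block y′) (offset y′) ne ⟩
    edge H (block y) (block y′)                       ∎
    where open ≡-Reasoning

  ⟨⟩-subst : ∀ {i j} (i≡j : i ≡ j) (a : Fin (size (Gs i))) →
             ⟨ j , subst (λ k → Fin (size (Gs k))) i≡j a ⟩ ≡ ⟨ i , a ⟩
  ⟨⟩-subst = embed-subst (size H) ns

record Copy {V : Set} (e : V → V → Bool) (G : Graph) : Set where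
  constructor copy
  field
    map   : V → Fin (size G)
    edges : ∀ p q → e p q ≡ edge G (map p) (map q)

copy-≅ : ∀ {V} {e : V → V → Bool} {G G′} → G ≅ G′ → Copy e G′ → Copy e G
copy-≅ {e = e} {G} {G′} (φ , φ-edge) (copy f f-copy) = copy (from ∘ f) λ p q → begin
  e p q                                     ≡⟨ f-copy p q ⟩
  edge G′ (f p) (f q)                       ≡⟨ sym (cong₂ (edge G′) (strictlyInverseˡ (f p)) (strictlyInverseˡ (f q))) ⟩
  edge G′ (to (from (f p))) (to (from (f q))) ≡⟨ sym (φ-edge (from (f p)) (from (f q))) ⟩
  edge G (from (f p)) (from (f q))          ∎
  where
  open Inverse φ
  open ≡-Reasoning

Clique : ℕ → Graph → Set
Clique m = Copy {Fin m} (λ j k → not ⌊ j ≟ k ⌋)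

clique-adjacent : ∀ {m G} (cl : Clique m G) {j k} → j ≢ k → edge G (Copy.map cl j) (Copy.map cl k) ≡ true
clique-adjacent (copy f f-copy) {j} {k} j≢k =
  trans (sym (f-copy j k)) (cong not (⌊⌋-false (j ≟ k) j≢k))

clique-injective : ∀ {m G} (cl : Clique m G) → Injective _≡_ _≡_ (Copy.map cl)
clique-injective {G = G} cl {j} {k} fj≡fk with j ≟ k
... | yes j≡k = j≡k
... | no j≢k = ⊥-elim (adjacent⇒≢ G (clique-adjacent cl j≢k) fj≡fk)

clique-size : ∀ {m G} → Clique m G → m ≤ size G
clique-size cl = injective⇒≤ (clique-injective cl)

-- Every colour class is a module: a vertex telling two vertices of a class apart lies in it.
Modular : {V A : Set} → (V → V → Bool) → (V → A) → Set
Modular e c = ∀ a b r → c a ≡ c b → e a r ≢ e b r → c r ≡ c a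

Prime : {V : Set} → (V → V → Bool) → Set₁
Prime {V} e = ∀ {A : Set} (c : V → A) → Modular e c →
              ∀ {p q} → p ≢ q → c p ≡ c q → ∀ r → c r ≡ c p

record Embedding {V : Set} (e : V → V → Bool) (G : Graph) : Set where
  constructor embedding
  field
    map   : V → Fin (size G)
    edges : ∀ {p q} → p ≢ q → map p ≢ map q × e p q ≡ edge G (map p) (map q)

module CopyInSubst {V : Set} {e : V → V → Bool} (H : Graph) (Gs : Fin (size H) → Graph)
                   (cp : Copy e (Subst H Gs)) where

  open SubstBlocks H Gs

  open Copy cp renaming (map to f; edges to f-copy)

  colour : V → Fin (size H)
  colour p = block (f p)

  copy-across : ∀ {p q} → colour p ≢ colour q → e p q ≡ edge H (colour p) (colour q)
  copy-across {p} {q} ne = trans (f-copy p q) (edge-across (f p) (f q) ne)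

  colour-modular : Modular e colour
  colour-modular a b r ca≡cb ear≢ebr with colour r ≟ colour a
  ... | yes cr≡ca = cr≡ca
  ... | no cr≢ca = ⊥-elim (ear≢ebr (begin
    e a r                       ≡⟨ copy-across (cr≢ca ∘ sym) ⟩
    edge H (colour a) (colour r) ≡⟨ cong (λ i → edge H i (colour r)) ca≡cb ⟩
    edge H (colour b) (colour r) ≡⟨ sym (copy-across (cr≢ca ∘ sym ∘ trans ca≡cb)) ⟩
    e b r                       ∎))
    where open ≡-Reasoning

  copy-within : ∀ i → (∀ p → colour p ≡ i) → Copy e (Gs i)
  copy-within i monochrome = copy g λ p q → begin
    e p q                           ≡⟨ f-copy p q ⟩
    edge (Subst H Gs) (f p) (f q)   ≡⟨ sym (cong₂ (edge (Subst H Gs)) (⟨i,g⟩ p) (⟨i,g⟩ q)) ⟩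
    edge (Subst H Gs) ⟨ i , g p ⟩ ⟨ i , g q ⟩ ≡⟨ edge-⟨⟩-same i (g p) (g q) ⟩
    edge (Gs i) (g p) (g q)         ∎
    where
    open ≡-Reasoning
    g : V → Fin (size (Gs i))
    g p = subst (λ k → Fin (size (Gs k))) (monochrome p) (offset (f p))
    ⟨i,g⟩ : ∀ p → ⟨ i , g p ⟩ ≡ f p
    ⟨i,g⟩ p = trans (⟨⟩-subst (monochrome p) (offset (f p))) (⟨block,offset⟩ (f p))

copy-in-Subst : ∀ {V} {e : V → V → Bool} {H Gs} → Prime e → ∀ {p₀ q₀} → p₀ ≢ q₀ →
                Copy e (Subst H Gs) → (Σ (Fin (size H)) λ i → Copy e (Gs i)) ⊎ Embedding e H
copy-in-Subst {e = e} {H} {Gs} prime {p₀} {q₀} p₀≢q₀ cp = dichotomy (colour p₀ ≟ colour q₀)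
  where
  open CopyInSubst H Gs cp
  dichotomy : Dec (colour p₀ ≡ colour q₀) → (Σ (Fin (size H)) λ i → Copy e (Gs i)) ⊎ Embedding e H
  dichotomy (yes same) = inj₁ (colour p₀ , copy-within (colour p₀) (prime colour colour-modular p₀≢q₀ same))
  dichotomy (no different) = inj₂ (embedding colour λ p≢q → injective p≢q , copy-across (injective p≢q))
    where
    injective : ∀ {p q} → p ≢ q → colour p ≢ colour q
    injective {p} p≢q cp≡cq = different (trans (everything p₀) (sym (everything q₀)))
      where
      everything : ∀ r → colour r ≡ colour p
      everything = prime colour colour-modular p≢q cp≡cq

clique-Union : ∀ {m t Gs} → Clique (suc m) (Union t Gs) → Σ (Fin t) λ i → Clique (suc m) (Gs i)
clique-Union {t = t} {Gs} cl = colour zero , copy-within (colour zero) monochrome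
  where
  open CopyInSubst (edgelessG t) Gs cl
  monochrome : ∀ j → colour j ≡ colour zero
  monochrome j with colour j ≟ colour zero
  ... | yes same = same
  ... | no different =
    ⊥-elim (true-≢-false (cong not (⌊⌋-false (j ≟ zero) λ { refl → different refl }))
                         (edge-edgeless _ _) (copy-across different))

clique-Inc : ∀ {m G S} → Clique (suc m) (Inc G S) → Clique m G
clique-Inc {m} {G} {S} cl@(copy f f-copy) = copy g λ j k → begin
  not ⌊ j ≟ k ⌋                                      ≡⟨ cong not (⌊⌋-⇔ (mk⇔ (cong (punchIn i₀)) (punchIn-injective i₀ j k)) (j ≟ k) _) ⟩
  not ⌊ punchIn i₀ j ≟ punchIn i₀ k ⌋                ≡⟨ f-copy (punchIn i₀ j) (punchIn i₀ k) ⟩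
  edge (Inc G S) (f (punchIn i₀ j)) (f (punchIn i₀ k)) ≡⟨ sym (cong₂ (edge (Inc G S)) (punchIn-punchOut (avoids j)) (punchIn-punchOut (avoids k))) ⟩
  edge (Inc G S) (suc (g j)) (suc (g k))             ≡⟨ edge-Inc-suc G S (g j) (g k) ⟩
  edge G (g j) (g k)                                 ∎
  where
  open ≡-Reasoning
  -- at most one clique vertex sits on the new vertex zero; punch it out
  avoiding : Σ (Fin (suc m)) λ i₀ → ∀ i → i ≢ i₀ → zero ≢ f i
  avoiding with any? (λ i → zero ≟ f i)
  ... | yes (i₀ , z≡fi₀) = i₀ , λ i i≢i₀ z≡fi → i≢i₀ (clique-injective cl (trans (sym z≡fi) z≡fi₀))
  ... | no none = zero , λ i _ z≡fi → none (i , z≡fi)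
  i₀ : Fin (suc m)
  i₀ = proj₁ avoiding
  avoids : ∀ i → zero ≢ f (punchIn i₀ i)
  avoids i = proj₂ avoiding (punchIn i₀ i) (punchInᵢ≢i i₀ i)
  g : Fin m → Fin (size G)
  g i = punchOut (avoids i)

td-clique : ∀ {k G m} → TDExpr k G → Clique m G → m ≤ k
td-clique {m = zero} _ _ = z≤n
td-clique {m = suc m} circ (copy f _) with f zero
... | ()
td-clique {m = suc m} (union t _ Gs ds) cl with clique-Union cl
... | i , cl-i = td-clique (ds i) cl-i
td-clique {m = suc m} (inc G S d) cl = s≤s (td-clique d (clique-Inc cl))
td-clique {m = suc m} (iso d φ) cl = td-clique d (copy-≅ φ cl)

data HalfVertex (n : ℕ) : Set where
  apex : HalfVertex n
  u w  : Fin n → HalfVertex n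

half : ∀ {n} → HalfVertex n → HalfVertex n → Bool
half apex  apex  = false
half apex  (u _) = false
half apex  (w _) = true
half (u _) apex  = false
half (u j) (u k) = not ⌊ j ≟ k ⌋
half (u j) (w i) = ⌊ j ≤? i ⌋
half (w _) apex  = true
half (w i) (u j) = ⌊ j ≤? i ⌋
half (w _) (w _) = false

module HalfPrime {m : ℕ} {A : Set} (c : HalfVertex (suc (suc m)) → A) (modular : Modular half c)
                 (κ : A) where

  Class : HalfVertex (suc (suc m)) → Set
  Class r = c r ≡ κ

  absorb : ∀ {a b} r → Class a → Class b → half a r ≢ half b r → Class r
  absorb {a} {b} r ca cb distinguishes = trans (modular a b r (trans ca (sym cb)) distinguishes) ca

  last : Fin (suc (suc m))
  last = fromℕ (suc m)

  from-apex-w : Class apex → ∀ i → Class (w i) → ∀ r → Class r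
  from-apex-w ca i cwi = everything
    where
    cw-last : Class (w last)
    cw-last = absorb (w last) ca cwi (λ ())
    everything : ∀ r → Class r
    everything apex  = ca
    everything (u j) = absorb (u j) ca cw-last (true-≢-false (⌊⌋-true (j ≤? last) (≤fromℕ j)) refl ∘ sym)
    everything (w k) = absorb (w k) ca cw-last (λ ())

  from-apex-u-suc : Class apex → ∀ j → Class (u (suc j)) → ∀ r → Class r
  from-apex-u-suc ca j cu = from-apex-w ca zero (absorb (w zero) ca cu
    (true-≢-false refl (⌊⌋-false (suc j ≤? zero {suc m}) λ ())))

  from-apex-u : Class apex → ∀ j → Class (u j) → ∀ r → Class r
  from-apex-u ca zero    cu = from-apex-u-suc ca (fromℕ m) (absorb (u last) ca cu (λ ()))
  from-apex-u ca (suc j) cu = from-apex-u-suc ca j cu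

  apex-from-w<w : ∀ {i k} → i Fin.< k → Class (w i) → Class (w k) → Class apex
  apex-from-w<w {i} {k} i<k cwi cwk = absorb apex cwi cuk (λ ())
    where
    cuk : Class (u k)
    cuk = absorb (u k) cwi cwk (true-≢-false (⌊⌋-true (k ≤? k) ≤ᶠ-refl) (⌊⌋-false (k ≤? i) (<⇒≱ i<k)) ∘ sym)

  apex-from-u<u : ∀ {j k} → j Fin.< k → Class (u j) → Class (u k) → Class apex
  apex-from-u<u {j} {k} j<k cuj cuk = absorb apex cuj cwj (λ ())
    where
    cwj : Class (w j)
    cwj = absorb (w j) cuj cuk (true-≢-false (⌊⌋-true (j ≤? j) ≤ᶠ-refl) (⌊⌋-false (k ≤? j) (<⇒≱ j<k)))

  apex-from : ∀ {p q} → p ≢ q → Class p → Class q → Class apex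
  apex-from {apex} {_}   _ cp _  = cp
  apex-from {u _} {apex} _ _  cq = cq
  apex-from {w _} {apex} _ _  cq = cq
  apex-from {u _} {w _}  _ cp cq = absorb apex cp cq (λ ())
  apex-from {w _} {u _}  _ cp cq = absorb apex cp cq (λ ())
  apex-from {u j} {u k} ne cp cq with <-cmp j k
  ... | tri< j<k _ _ = apex-from-u<u j<k cp cq
  ... | tri≈ _ j≡k _ = ⊥-elim (ne (cong u j≡k))
  ... | tri> _ _ k<j = apex-from-u<u k<j cq cp
  apex-from {w i} {w k} ne cp cq with <-cmp i k
  ... | tri< i<k _ _ = apex-from-w<w i<k cp cq
  ... | tri≈ _ i≡k _ = ⊥-elim (ne (cong w i≡k))
  ... | tri> _ _ k<i = apex-from-w<w k<i cq cp

  spans : ∀ {p q} → p ≢ q → Class p → Class q → ∀ r → Class r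
  spans {apex} {apex} ne _  _  = ⊥-elim (ne refl)
  spans {apex} {u k}  _  ca cu = from-apex-u ca k cu
  spans {apex} {w k}  _  ca cw = from-apex-w ca k cw
  spans {u j}         ne cu cq = from-apex-u (apex-from ne cu cq) j cu
  spans {w i}         ne cw cq = from-apex-w (apex-from ne cw cq) i cw

half-prime : ∀ {m} → Prime (half {suc (suc m)})
half-prime c modular {p} p≢q cp≡cq = HalfPrime.spans c modular (c p) p≢q refl (sym cp≡cq)

half-clique : ∀ {n G} → Embedding (half {n}) G → Clique n G
half-clique {G = G} (embedding c c-emb) = copy (c ∘ u) adjacency
  where
  adjacency : ∀ j k → not ⌊ j ≟ k ⌋ ≡ edge G (c (u j)) (c (u k))
  adjacency j k with j ≟ k
  ... | yes refl = sym (edge-irrefl G (c (u j)))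
  ... | no j≢k = trans (cong not (sym (⌊⌋-false (j ≟ k) j≢k))) (proj₂ (c-emb λ { refl → j≢k refl }))

half-not-in-edgeless : ∀ {n t} → ¬ Embedding (half {suc n}) (edgelessG t)
half-not-in-edgeless (embedding c c-emb) =
  true-≢-false refl (edge-edgeless _ _) (proj₂ (c-emb {apex} {w zero} λ ()))

half-not-in-complete : ∀ {n t} → ¬ Embedding (half {suc n}) (completeG t)
half-not-in-complete (embedding c c-emb) with c-emb {apex} {u zero} (λ ())
... | c≢ , apex≁u = true-≢-false (edge-complete c≢) refl (sym apex≁u)

2+m≰m : ∀ {m} → ¬ suc (suc m) ≤ m
2+m≰m {m} 2+m≤m = 1+n≰n (≤-trans (n≤1+n (suc m)) 2+m≤m)

no-copy-in-Subst : ∀ {m H Gs} → (∀ i → ¬ Copy (half {suc (suc m)}) (Gs i)) → ¬ Embedding half H →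
                   ¬ Copy half (Subst H Gs)
no-copy-in-Subst no-block no-embedding =
  [ uncurry no-block , no-embedding ]′ ∘ copy-in-Subst half-prime {apex} {w zero} (λ ())

no-half-copy : ∀ {h ℓ m G} → h ≤ m → ℓ ≤ m → (MW h MTD ℓ) G → ¬ Copy (half {suc (suc m)}) G
no-half-copy _ _ emptyE (copy f _) with f apex
... | ()
no-half-copy _ _ bullet (copy f f-copy) with f apex | f (w zero) | f-copy apex (w zero)
... | zero | zero | ()
no-half-copy h≤m ℓ≤m (union t _ Gs ds) =
  no-copy-in-Subst (λ i → no-half-copy h≤m ℓ≤m (ds i)) half-not-in-edgeless
no-half-copy h≤m ℓ≤m (join t _ Gs ds) =
  no-copy-in-Subst (λ i → no-half-copy h≤m ℓ≤m (ds i)) half-not-in-complete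
no-half-copy h≤m ℓ≤m (substS H |H|≤h Gs ds) =
  no-copy-in-Subst (λ i → no-half-copy h≤m ℓ≤m (ds i))
    λ emb → 2+m≰m (≤-trans (clique-size (half-clique emb)) (≤-trans |H|≤h h≤m))
no-half-copy h≤m ℓ≤m (substT H td Gs ds) =
  no-copy-in-Subst (λ i → no-half-copy h≤m ℓ≤m (ds i))
    λ emb → 2+m≰m (≤-trans (td-clique td (half-clique emb)) ℓ≤m)
no-half-copy h≤m ℓ≤m (iso d φ) = no-half-copy h≤m ℓ≤m d ∘ copy-≅ φ

-- In halfGraph (suc n) the join vertex is u₀ and the union vertex is w₀; older indices shift by one.
halfGraph halfGraph′ : ℕ → Graph
halfGraph zero    = emptyG
halfGraph (suc n) = Join 2 (oneG ∷ halfGraph′ n ∷ [])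
halfGraph′ n      = Union 2 (oneG ∷ halfGraph n ∷ [])

module JoinBlocks (n : ℕ) = SubstBlocks (completeG 2) (oneG ∷ halfGraph′ n ∷ [])
module UnionBlocks (n : ℕ) = SubstBlocks (edgelessG 2) (oneG ∷ halfGraph n ∷ [])

one : Fin 2
one = suc zero

new-u new-w : ∀ n → Fin (size (halfGraph (suc n)))
new-u n = JoinBlocks.⟨_,_⟩ n zero zero
new-w n    = JoinBlocks.⟨_,_⟩ n one (UnionBlocks.⟨_,_⟩ n zero zero)

deeper : ∀ n → Fin (size (halfGraph n)) → Fin (size (halfGraph (suc n)))
deeper n y = JoinBlocks.⟨_,_⟩ n one (UnionBlocks.⟨_,_⟩ n one y)

edge-new-u-deeper : ∀ n y → edge (halfGraph (suc n)) (new-u n) (deeper n y) ≡ true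
edge-new-u-deeper n y = JoinBlocks.edge-⟨⟩-diff n zero zero one (UnionBlocks.⟨_,_⟩ n one y) (λ ())

edge-new-u-new-w : ∀ n → edge (halfGraph (suc n)) (new-u n) (new-w n) ≡ true
edge-new-u-new-w n = JoinBlocks.edge-⟨⟩-diff n zero zero one (UnionBlocks.⟨_,_⟩ n zero zero) (λ ())

edge-new-w-deeper : ∀ n y → edge (halfGraph (suc n)) (new-w n) (deeper n y) ≡ false
edge-new-w-deeper n y =
  trans (JoinBlocks.edge-⟨⟩-same n one (UnionBlocks.⟨_,_⟩ n zero zero) (UnionBlocks.⟨_,_⟩ n one y))
        (UnionBlocks.edge-⟨⟩-diff n zero zero one y (λ ()))

edge-deeper : ∀ n y y′ → edge (halfGraph (suc n)) (deeper n y) (deeper n y′) ≡ edge (halfGraph n) y y′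
edge-deeper n y y′ =
  trans (JoinBlocks.edge-⟨⟩-same n one (UnionBlocks.⟨_,_⟩ n one y) (UnionBlocks.⟨_,_⟩ n one y′))
        (UnionBlocks.edge-⟨⟩-same n one y y′)

u-vertex w-vertex : ∀ n → Fin n → Fin (size (halfGraph n))
u-vertex (suc n) zero    = new-u n
u-vertex (suc n) (suc j) = deeper n (u-vertex n j)
w-vertex (suc n) zero    = new-w n
w-vertex (suc n) (suc i) = deeper n (w-vertex n i)

apex-neighbours : ∀ n → Fin (size (halfGraph n)) → Bool
apex-neighbours (suc n) y with JoinBlocks.locate n y
... | zero , _ = false
... | suc zero , y′ with UnionBlocks.locate n y′
...   | zero , _ = true
...   | suc zero , y″ = apex-neighbours n y″

apex-≁-u : ∀ n j → apex-neighbours n (u-vertex n j) ≡ false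
apex-≁-u (suc n) zero rewrite JoinBlocks.locate-⟨⟩ n zero zero = refl
apex-≁-u (suc n) (suc j)
  rewrite JoinBlocks.locate-⟨⟩ n one (UnionBlocks.⟨_,_⟩ n one (u-vertex n j))
        | UnionBlocks.locate-⟨⟩ n one (u-vertex n j) = apex-≁-u n j

apex-∼-w : ∀ n i → apex-neighbours n (w-vertex n i) ≡ true
apex-∼-w (suc n) zero
  rewrite JoinBlocks.locate-⟨⟩ n one (UnionBlocks.⟨_,_⟩ n zero zero)
        | UnionBlocks.locate-⟨⟩ n zero zero = refl
apex-∼-w (suc n) (suc i)
  rewrite JoinBlocks.locate-⟨⟩ n one (UnionBlocks.⟨_,_⟩ n one (w-vertex n i))
        | UnionBlocks.locate-⟨⟩ n one (w-vertex n i) = apex-∼-w n i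

edge-uu : ∀ n j k → edge (halfGraph n) (u-vertex n j) (u-vertex n k) ≡ not ⌊ j ≟ k ⌋
edge-uu (suc n) zero    zero    = edge-irrefl (halfGraph (suc n)) (new-u n)
edge-uu (suc n) zero    (suc k) = edge-new-u-deeper n (u-vertex n k)
edge-uu (suc n) (suc j) zero    =
  trans (edge-sym (halfGraph (suc n)) (deeper n (u-vertex n j)) (new-u n)) (edge-new-u-deeper n (u-vertex n j))
edge-uu (suc n) (suc j) (suc k) = begin
  edge (halfGraph (suc n)) (deeper n (u-vertex n j)) (deeper n (u-vertex n k)) ≡⟨ edge-deeper n (u-vertex n j) (u-vertex n k) ⟩
  edge (halfGraph n) (u-vertex n j) (u-vertex n k)                           ≡⟨ edge-uu n j k ⟩
  not ⌊ j ≟ k ⌋                                                              ≡⟨ cong not (⌊⌋-⇔ (mk⇔ (cong suc) suc-injective) (j ≟ k) (suc j ≟ suc k)) ⟩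
  not ⌊ suc j ≟ suc k ⌋                                                      ∎
  where open ≡-Reasoning

edge-uw : ∀ n j i → edge (halfGraph n) (u-vertex n j) (w-vertex n i) ≡ ⌊ j ≤? i ⌋
edge-uw (suc n) zero    zero    = edge-new-u-new-w n
edge-uw (suc n) zero    (suc i) = edge-new-u-deeper n (w-vertex n i)
edge-uw (suc n) (suc j) zero    =
  trans (edge-sym (halfGraph (suc n)) (deeper n (u-vertex n j)) (new-w n)) (edge-new-w-deeper n (u-vertex n j))
edge-uw (suc n) (suc j) (suc i) = begin
  edge (halfGraph (suc n)) (deeper n (u-vertex n j)) (deeper n (w-vertex n i)) ≡⟨ edge-deeper n (u-vertex n j) (w-vertex n i) ⟩
  edge (halfGraph n) (u-vertex n j) (w-vertex n i)                           ≡⟨ edge-uw n j i ⟩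
  ⌊ j ≤? i ⌋                                                                 ≡⟨ ⌊⌋-⇔ (mk⇔ s≤s s≤s⁻¹) (j ≤? i) (suc j ≤? suc i) ⟩
  ⌊ suc j ≤? suc i ⌋                                                         ∎
  where open ≡-Reasoning

edge-ww : ∀ n i k → edge (halfGraph n) (w-vertex n i) (w-vertex n k) ≡ false
edge-ww (suc n) zero    zero    = edge-irrefl (halfGraph (suc n)) (new-w n)
edge-ww (suc n) zero    (suc k) = edge-new-w-deeper n (w-vertex n k)
edge-ww (suc n) (suc i) zero    =
  trans (edge-sym (halfGraph (suc n)) (deeper n (w-vertex n i)) (new-w n)) (edge-new-w-deeper n (w-vertex n i))
edge-ww (suc n) (suc i) (suc k) = trans (edge-deeper n (w-vertex n i) (w-vertex n k)) (edge-ww n i k)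

half-copy : ∀ n → Copy half (Inc (halfGraph n) (apex-neighbours n))
half-copy n = copy vertex edges
  where
  G : Graph
  G = Inc (halfGraph n) (apex-neighbours n)
  inc-zero : ∀ y → edge G zero (suc y) ≡ apex-neighbours n y
  inc-zero = edge-Inc-zero (halfGraph n) (apex-neighbours n)
  inc-suc : ∀ y y′ → edge G (suc y) (suc y′) ≡ edge (halfGraph n) y y′
  inc-suc = edge-Inc-suc (halfGraph n) (apex-neighbours n)
  vertex : HalfVertex n → Fin (size G)
  vertex apex  = zero
  vertex (u j) = suc (u-vertex n j)
  vertex (w i) = suc (w-vertex n i)
  edges : ∀ p q → half p q ≡ edge G (vertex p) (vertex q)
  edges apex  apex  = refl
  edges apex  (u j) = sym (trans (inc-zero (u-vertex n j)) (apex-≁-u n j))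
  edges apex  (w i) = sym (trans (inc-zero (w-vertex n i)) (apex-∼-w n i))
  edges (u j) apex  = trans (edges apex (u j)) (edge-sym G zero (vertex (u j)))
  edges (w i) apex  = trans (edges apex (w i)) (edge-sym G zero (vertex (w i)))
  edges (u j) (u k) = sym (trans (inc-suc (u-vertex n j) (u-vertex n k)) (edge-uu n j k))
  edges (u j) (w i) = sym (trans (inc-suc (u-vertex n j) (w-vertex n i)) (edge-uw n j i))
  edges (w i) (u j) = trans (edges (u j) (w i)) (edge-sym G (vertex (u j)) (vertex (w i)))
  edges (w i) (w k) = sym (trans (inc-suc (w-vertex n i) (w-vertex n k)) (edge-ww n i k))

halfGraph-cograph : ∀ n → (TD 0 MW 0) (halfGraph n)
halfGraph-cograph zero    = circ
halfGraph-cograph (suc n) = join 2 2≤2 (oneG ∷ halfGraph′ n ∷ []) λ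
  { zero       → bullet
  ; (suc zero) → union 2 2≤2 (oneG ∷ halfGraph n ∷ []) λ
      { zero       → bullet
      ; (suc zero) → halfGraph-cograph n } }
  where
  2≤2 : 2 ≤ 2
  2≤2 = s≤s (s≤s z≤n)

lemma31 : (h ℓ : ℕ) → Σ Graph (λ G → ¬ (MW h MTD ℓ) G × (TD 1 MW 0) G)
lemma31 h ℓ =
  Inc (halfGraph n) (apex-neighbours n) ,
  (λ G∈MW → no-half-copy (m≤m+n h ℓ) (m≤n+m ℓ h) G∈MW (half-copy n)) ,
  inc (halfGraph n) (apex-neighbours n) (halfGraph-cograph n)
  where
  n : ℕ
  n = suc (suc (h + ℓ))
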